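{- Let $A=(1,4,9,\dots)$ be the sequence of perfect squares, $a_j=j^2$. For all integers $n\ge 1$ and all even integers $\ell$ with $0\le\ell\le n$, we have $A^\varphi(n,\ell)\le 3\ell^2+20\ell+57$.
   Context: $\varphi$ denotes Euler's totient function. For a sequence $A=(a_1,a_2,\dots)$ of positive integers and an integer $n\ge 1$, the partial evaluations $A^\varphi(n,k)$ for $0\le k\le n$ are defined recursively by $A^\varphi(n,n)=0$ and $A^\varphi(n,k-1)=\varphi\big(a_k+A^\varphi(n,k)\big)$ for $1\le k\le n$. -}

module Defs where

open import Data.Nat using (ℕ; zero; suc; _+_; _*_; _∸_)
open import Data.Nat.GCD using (gcd)
open import Data.List using (List; length; filter)
open import Data.List.Base using (upTo)
open import Data.Nat using (_≟_)

-- Euler's totient: φ n = #{ k ∈ {1,…,n} : gcd k n = 1 }  (so φ 0 = 0, φ 1 = 1)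
φ : ℕ → ℕ
φ n = length (filter (λ k → gcd (suc k) n ≟ 1) (upTo n))

-- goA a n d computes A^φ(n, n ∸ d) for d ≤ n:
--   A^φ(n,n) = 0,  A^φ(n,k-1) = φ(a_k + A^φ(n,k))
goA : (ℕ → ℕ) → ℕ → ℕ → ℕ
goA a n zero    = 0
goA a n (suc d) = φ (a (n ∸ d) + goA a n d)

-- partial evaluation A^φ(n,k), meaningful for 0 ≤ k ≤ n; the sequence is
-- given as a function a with a j = a_j (j ≥ 1)
Aφ : (ℕ → ℕ) → ℕ → ℕ → ℕ
Aφ a n k = goA a n (n ∸ k)

squares : ℕ → ℕ
squares j = j * j

-- For 1 ≤ k ≤ n the value Aφ(n,k) is even: it is 0, or the totient of (k+1)² + … ≥ 3,
-- and φ(m) is even for m ≥ 3 because x ↦ m − x pairs off the units below m.  So with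
-- ℓ = 2t write Aφ(n,2t+2) = 2s; then Aφ(n,2t+1) = φ(2(2(t+1)² + s)) ≤ 2(t+1)² + s since
-- φ(2m) ≤ m, and Aφ(n,2t) ≤ (2t+1)² + 2(t+1)² + s.  By induction on n − ℓ, the bound at
-- ℓ + 2 gives s ≤ 6t² + 32t + 54, and the three terms add up to exactly 3ℓ² + 20ℓ + 57.
module Submission where

open import Defs
open import Data.Nat using (ℕ; zero; suc; _+_; _*_; _∸_; _≤_; _<_; z≤n; s≤s; _≟_)
open import Data.Nat.Divisibility
  using (_∣_; divides; quotient; m∣n⇒n≡quotient*m; n∣m*n; ∣1⇒≡1; ∣m∣n⇒∣m+n)
open import Data.Nat.Properties
open import Data.Nat.GCD using (gcd; gcd-GCD; gcd-comm; gcd-greatest; module GCD)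
open import Data.Nat.Tactic.RingSolver using (solve; solve-∀)
open import Data.List using (List; []; _∷_; [_]; _++_; length; filter; applyUpTo; upTo)
open import Data.List.Properties
  using (length-filter; length-upTo; length-++; filter-++; filter-reject; applyUpTo-∷ʳ; upTo-∷ʳ)
open import Data.Sum using (inj₁; inj₂)
open import Function using (_∘_)
open import Relation.Nullary using (¬_; yes; no; contradiction)
open import Relation.Unary using (Pred; Decidable)
open import Relation.Binary.PropositionalEquality using (_≡_; refl; sym; trans; cong; subst)
open ≤-Reasoning

m*2≤1+n*2⇒m≤n : ∀ m n → m * 2 ≤ suc (n * 2) → m ≤ n
m*2≤1+n*2⇒m≤n m n le = ≤-pred (*-cancelʳ-< 2 m (suc n) (s≤s le))

m+[n+m]≡n+m*2 : ∀ m n → m + (n + m) ≡ n + m * 2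
m+[n+m]≡n+m*2 = solve-∀

module _ {a p} {A : Set a} {P : Pred A p} (P? : Decidable P) where

  length-filter-∷≤ : ∀ x xs → length (filter P? (x ∷ xs)) ≤ suc (length (filter P? xs))
  length-filter-∷≤ x xs with P? x
  ... | yes _ = ≤-refl
  ... | no  _ = n≤1+n _

  length-filter-applyUpTo[m*2]≤m : ∀ (f : ℕ → A) m → (∀ k → ¬ P (f (suc (k * 2)))) →
                                   length (filter P? (applyUpTo f (m * 2))) ≤ m
  length-filter-applyUpTo[m*2]≤m f zero    _       = ≤-refl
  length-filter-applyUpTo[m*2]≤m f (suc m) ¬P-odd = begin
    length (filter P? (f 0 ∷ f 1 ∷ rest))  ≤⟨ length-filter-∷≤ (f 0) (f 1 ∷ rest) ⟩
    suc (length (filter P? (f 1 ∷ rest)))  ≡⟨ cong (suc ∘ length) (filter-reject P? (¬P-odd 0)) ⟩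
    suc (length (filter P? rest))
      ≤⟨ s≤s (length-filter-applyUpTo[m*2]≤m (f ∘ suc ∘ suc) m (¬P-odd ∘ suc)) ⟩
    suc m                                  ∎
    where
    rest : List A
    rest = applyUpTo (f ∘ suc ∘ suc) (m * 2)

  length-filter-++ : ∀ xs ys →
                     length (filter P? (xs ++ ys)) ≡ length (filter P? xs) + length (filter P? ys)
  length-filter-++ xs ys = trans (cong length (filter-++ P? xs ys)) (length-++ (filter P? xs))

  length-filter-[x]≡length-filter-[y] : ∀ {x y} → (P x → P y) → (P y → P x) →
                                        length (filter P? [ x ]) ≡ length (filter P? [ y ])
  length-filter-[x]≡length-filter-[y] {x} {y} x⇒y y⇒x with P? x | P? y
  ... | yes _  | yes _  = refl
  ... | no  _  | no  _  = refl
  ... | yes Px | no ¬Py = contradiction (x⇒y Px) ¬Py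
  ... | no ¬Px | yes Py = contradiction (y⇒x Py) ¬Px

  2∣length-filter-applyUpTo : ∀ (f : ℕ → A) k →
                              (∀ i j → i + j ≡ k → P (f i) → P (f j)) →
                              (∀ i → i + i ≡ k → ¬ P (f i)) →
                              2 ∣ length (filter P? (applyUpTo f (suc k)))
  2∣length-filter-applyUpTo f zero _ ¬P-mid with P? (f 0)
  ... | yes Pf₀ = contradiction Pf₀ (¬P-mid 0 refl)
  ... | no _    = divides 0 refl
  2∣length-filter-applyUpTo f (suc zero) P-sym _ with P? (f 0)
  ... | yes Pf₀ with P? (f 1)
  ...   | yes _   = divides 1 refl
  ...   | no ¬Pf₁ = contradiction (P-sym 0 1 refl Pf₀) ¬Pf₁
  2∣length-filter-applyUpTo f (suc zero) P-sym _ | no ¬Pf₀ with P? (f 1)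
  ...   | yes Pf₁ = contradiction (P-sym 1 0 refl Pf₁) ¬Pf₀
  ...   | no _    = divides 0 refl
  2∣length-filter-applyUpTo f (suc (suc k)) P-sym ¬P-mid =
    subst (2 ∣_) (sym count≡) (∣m∣n⇒∣m+n inner-even (n∣m*n end))
    where
    inner : List A
    inner = applyUpTo (f ∘ suc) (suc k)
    last : A
    last = f (suc (suc k))
    end : ℕ
    end = length (filter P? [ f 0 ])
    inner-even : 2 ∣ length (filter P? inner)
    inner-even = 2∣length-filter-applyUpTo (f ∘ suc) k
      (λ i j i+j≡k → P-sym (suc i) (suc j) (trans (cong suc (+-suc i j)) (cong (suc ∘ suc) i+j≡k)))
      (λ i i+i≡k → ¬P-mid (suc i) (trans (cong suc (+-suc i i)) (cong (suc ∘ suc) i+i≡k)))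
    count≡ : length (filter P? (applyUpTo f (suc (suc (suc k))))) ≡ length (filter P? inner) + end * 2
    count≡ = begin-equality
      length (filter P? ([ f 0 ] ++ applyUpTo (f ∘ suc) (suc (suc k))))
        ≡⟨ cong (λ xs → length (filter P? ([ f 0 ] ++ xs))) (sym (applyUpTo-∷ʳ (f ∘ suc) (suc k))) ⟩
      length (filter P? ([ f 0 ] ++ (inner ++ [ last ])))
        ≡⟨ length-filter-++ [ f 0 ] (inner ++ [ last ]) ⟩
      end + length (filter P? (inner ++ [ last ]))
        ≡⟨ cong (end +_) (length-filter-++ inner [ last ]) ⟩
      end + (length (filter P? inner) + length (filter P? [ last ]))
        ≡⟨ cong (λ e → end + (length (filter P? inner) + e))
             (length-filter-[x]≡length-filter-[y] (P-sym _ _ refl) (P-sym _ 0 (+-identityʳ _))) ⟨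
      end + (length (filter P? inner) + end)
        ≡⟨ m+[n+m]≡n+m*2 end (length (filter P? inner)) ⟩
      length (filter P? inner) + end * 2 ∎

gcd[m,m+n]≡gcd[n,m+n] : ∀ m n → gcd m (m + n) ≡ gcd n (m + n)
gcd[m,m+n]≡gcd[n,m+n] m n = begin-equality
  gcd m (m + n)  ≡⟨ GCD.unique (gcd-GCD m (m + n)) (GCD.step (gcd-GCD m n)) ⟩
  gcd m n        ≡⟨ gcd-comm m n ⟩
  gcd n m        ≡⟨ GCD.unique (gcd-GCD n (n + m)) (GCD.step (gcd-GCD n m)) ⟨
  gcd n (n + m)  ≡⟨ cong (gcd n) (+-comm n m) ⟩
  gcd n (m + n)  ∎

gcd[m,m+m]≡m : ∀ m → gcd m (m + m) ≡ m
gcd[m,m+m]≡m m = GCD.unique (gcd-GCD m (m + m)) (GCD.step GCD.refl)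

φ[n]≤n : ∀ n → φ n ≤ n
φ[n]≤n n = ≤-trans (length-filter (λ k → gcd (suc k) n ≟ 1) (upTo n)) (≤-reflexive (length-upTo n))

φ[n*2]≤n : ∀ n → φ (n * 2) ≤ n
φ[n*2]≤n n = length-filter-applyUpTo[m*2]≤m (λ k → gcd (suc k) (n * 2) ≟ 1) (λ k → k) n even-not-coprime
  where
  even-not-coprime : ∀ k → ¬ gcd (suc k * 2) (n * 2) ≡ 1
  even-not-coprime k gcd≡1
    with () ← ∣1⇒≡1 (subst (2 ∣_) gcd≡1 (gcd-greatest (n∣m*n (suc k)) (n∣m*n n)))

2∣φ : ∀ {n} → 3 ≤ n → 2 ∣ φ n
2∣φ {n@(suc (suc m))} (s≤s (s≤s (s≤s _))) =
  subst (2 ∣_) (sym φ≡) (2∣length-filter-applyUpTo P? (λ k → k) m symmetric ¬P-mid)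
  where
  P? : Decidable (λ k → gcd (suc k) n ≡ 1)
  P? = λ k → gcd (suc k) n ≟ 1
  n≡ : ∀ i j → i + j ≡ m → n ≡ suc i + suc j
  n≡ i j i+j≡m = sym (trans (cong suc (+-suc i j)) (cong (suc ∘ suc) i+j≡m))
  symmetric : ∀ i j → i + j ≡ m → gcd (suc i) n ≡ 1 → gcd (suc j) n ≡ 1
  symmetric i j i+j≡m = subst (λ N → gcd (suc i) N ≡ 1 → gcd (suc j) N ≡ 1) (sym (n≡ i j i+j≡m))
    (trans (sym (gcd[m,m+n]≡gcd[n,m+n] (suc i) (suc j))))
  ¬P-mid : ∀ i → i + i ≡ m → ¬ gcd (suc i) n ≡ 1
  ¬P-mid zero    ()
  ¬P-mid (suc i) i+i≡m = subst (λ N → ¬ gcd (suc (suc i)) N ≡ 1) (sym (n≡ (suc i) (suc i) i+i≡m))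
    (λ gcd≡1 → contradiction (trans (sym (gcd[m,m+m]≡m (suc (suc i)))) gcd≡1) λ ())
  φ≡ : φ n ≡ length (filter P? (upTo (suc m)))
  φ≡ = begin-equality
    length (filter P? (upTo n))                          ≡⟨ cong (length ∘ filter P?) (upTo-∷ʳ (suc m)) ⟨
    length (filter P? (upTo (suc m) ++ [ suc m ]))       ≡⟨ length-filter-++ P? (upTo (suc m)) [ suc m ] ⟩
    length (filter P? (upTo (suc m))) + length (filter P? [ suc m ])
      ≡⟨ cong (λ xs → length (filter P? (upTo (suc m))) + length xs)
              (filter-reject P? {x = suc m} {xs = []} gcd[n,n]≢1) ⟩
    length (filter P? (upTo (suc m))) + 0                ≡⟨ +-identityʳ _ ⟩
    length (filter P? (upTo (suc m)))                    ∎
    where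
    gcd[n,n]≢1 : ¬ gcd n n ≡ 1
    gcd[n,n]≢1 gcd≡1 = contradiction (trans (sym (GCD.unique (gcd-GCD n n) GCD.refl)) gcd≡1) λ ()

Aφ[n,n]≡0 : ∀ a n → Aφ a n n ≡ 0
Aφ[n,n]≡0 a n = cong (goA a n) (n∸n≡0 n)

Aφ-unfold : ∀ a {n k} → k < n → Aφ a n k ≡ φ (a (suc k) + Aφ a n (suc k))
Aφ-unfold a {n} {k} k<n = begin-equality
  goA a n (n ∸ k)                           ≡⟨ cong (goA a n) (+-∸-assoc 1 k<n) ⟩
  φ (a (n ∸ (n ∸ suc k)) + Aφ a n (suc k))
    ≡⟨ cong (λ j → φ (a j + Aφ a n (suc k))) (m∸[m∸n]≡n k<n) ⟩
  φ (a (suc k) + Aφ a n (suc k))            ∎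

2∣Aφ : ∀ a {n k} → k < n → 3 ≤ a (suc k) → 2 ∣ Aφ a n k
2∣Aφ a k<n 3≤a = subst (2 ∣_) (sym (Aφ-unfold a k<n)) (2∣φ (≤-trans 3≤a (m≤m+n _ _)))

2∣Aφ-squares : ∀ {n k} → suc k ≤ n → 2 ∣ Aφ squares n (suc k)
2∣Aφ-squares {k = k} 1+k≤n with m≤n⇒m<n∨m≡n 1+k≤n
... | inj₁ 1+k<n = 2∣Aφ squares 1+k<n (≤-trans (n≤1+n 3) (*-mono-≤ 2≤2+k 2≤2+k))
  where
  2≤2+k : 2 ≤ suc (suc k)
  2≤2+k = s≤s (s≤s z≤n)
... | inj₂ refl = subst (2 ∣_) (sym (Aφ[n,n]≡0 squares (suc k))) (divides 0 refl)

halve-bound[2t+2] : ∀ t s → s * 2 ≤ 3 * (suc t * 2 * (suc t * 2)) + 20 * (suc t * 2) + 57 →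
                    s ≤ 6 * (t * t) + 32 * t + 54
halve-bound[2t+2] t s le = m*2≤1+n*2⇒m≤n s _ (begin
  s * 2                                                   ≤⟨ le ⟩
  3 * (suc t * 2 * (suc t * 2)) + 20 * (suc t * 2) + 57   ≡⟨ solve (t ∷ []) ⟩
  suc ((6 * (t * t) + 32 * t + 54) * 2)                   ∎)

φ[[2t+2]²+2s]≤2[t+1]²+s : ∀ t s → φ (suc t * 2 * (suc t * 2) + s * 2) ≤ suc t * suc t * 2 + s
φ[[2t+2]²+2s]≤2[t+1]²+s t s = begin
  φ (suc t * 2 * (suc t * 2) + s * 2)  ≡⟨ cong φ even-form ⟩
  φ ((suc t * suc t * 2 + s) * 2)      ≤⟨ φ[n*2]≤n (suc t * suc t * 2 + s) ⟩
  suc t * suc t * 2 + s                ∎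
  where
  even-form : suc t * 2 * (suc t * 2) + s * 2 ≡ (suc t * suc t * 2 + s) * 2
  even-form = solve (t ∷ s ∷ [])

Aφ-squares[n,2t]≤ : ∀ d t {n} → d + t * 2 ≡ n →
                    Aφ squares n (t * 2) ≤ 3 * (t * 2 * (t * 2)) + 20 * (t * 2) + 57
Aφ-squares[n,2t+1]≤ : ∀ d t {n} → d + suc (t * 2) ≡ n →
                      Aφ squares n (suc (t * 2)) ≤ suc t * suc t * 2 + (6 * (t * t) + 32 * t + 54)

Aφ-squares[n,2t]≤ zero t refl = ≤-trans (≤-reflexive (Aφ[n,n]≡0 squares (t * 2))) z≤n
Aφ-squares[n,2t]≤ (suc d) t {n} e = begin
  Aφ squares n (t * 2)                         ≡⟨ Aφ-unfold squares 2t<n ⟩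
  φ (squares (suc (t * 2)) + odd-value)        ≤⟨ φ[n]≤n (squares (suc (t * 2)) + odd-value) ⟩
  suc (t * 2) * suc (t * 2) + odd-value        ≤⟨ +-monoʳ-≤ _ (Aφ-squares[n,2t+1]≤ d t (trans (+-suc d _) e)) ⟩
  suc (t * 2) * suc (t * 2) + (suc t * suc t * 2 + (6 * (t * t) + 32 * t + 54))
                                               ≡⟨ solve (t ∷ []) ⟩
  3 * (t * 2 * (t * 2)) + 20 * (t * 2) + 57    ∎
  where
  2t<n : t * 2 < n
  2t<n = ≤-trans (s≤s (m≤n+m _ d)) (≤-reflexive e)
  odd-value : ℕ
  odd-value = Aφ squares n (suc (t * 2))

Aφ-squares[n,2t+1]≤ zero t refl = ≤-trans (≤-reflexive (Aφ[n,n]≡0 squares (suc (t * 2)))) z≤n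
Aφ-squares[n,2t+1]≤ (suc d) t {n} e = begin
  Aφ squares n (suc (t * 2))                ≡⟨ Aφ-unfold squares 2t+2≤n ⟩
  φ (squares (suc t * 2) + even-value)      ≡⟨ cong (λ y → φ (squares (suc t * 2) + y)) even-value≡2s ⟩
  φ (squares (suc t * 2) + s * 2)           ≤⟨ φ[[2t+2]²+2s]≤2[t+1]²+s t s ⟩
  suc t * suc t * 2 + s                     ≤⟨ +-monoʳ-≤ _ (halve-bound[2t+2] t s s*2≤) ⟩
  suc t * suc t * 2 + (6 * (t * t) + 32 * t + 54) ∎
  where
  2t+2≤n : suc t * 2 ≤ n
  2t+2≤n = ≤-trans (m≤n+m _ d) (≤-reflexive (trans (+-suc d _) e))
  even-value : ℕ
  even-value = Aφ squares n (suc t * 2)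
  s : ℕ
  s = quotient (2∣Aφ-squares 2t+2≤n)
  even-value≡2s : even-value ≡ s * 2
  even-value≡2s = m∣n⇒n≡quotient*m (2∣Aφ-squares 2t+2≤n)
  s*2≤ : s * 2 ≤ 3 * (suc t * 2 * (suc t * 2)) + 20 * (suc t * 2) + 57
  s*2≤ = subst (_≤ _) even-value≡2s (Aφ-squares[n,2t]≤ d (suc t) (trans (+-suc d _) e))

corollary4p1p1 : ∀ (n ℓ : ℕ) → 1 ≤ n → 2 ∣ ℓ → ℓ ≤ n →
    Aφ squares n ℓ ≤ 3 * (ℓ * ℓ) + 20 * ℓ + 57
corollary4p1p1 n ℓ _ (divides t refl) ℓ≤n = Aφ-squares[n,2t]≤ (n ∸ t * 2) t (m∸n+n≡m ℓ≤n)
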